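{- For any $\alpha\ge1$ there exist constants $c=c(\alpha)<1$ and $C=C(\alpha)$ such that for every $n$ the following holds: let $M=\{v_1,\dots,v_n\}$ with $d_M(v_i,v_j)=|i-j|$ (equally spaced points on a line); if a subset $S\subseteq M$ is $\alpha$-approximated by an HST (i.e., there is a $1$-HST metric $d_T$ on $S$ with $d_M(u,v)\le d_T(u,v)\le\alpha d_M(u,v)$ for all $u,v\in S$), then $|S|\le C n^c$.
   Context: A $1$-HST (HST) is a metric space on the leaves of a rooted tree $T$ with vertex labels $\Delta(u)\ge0$, $\Delta(u)=0$ iff $u$ is a leaf, $\Delta(u)\le\Delta(v)$ whenever $u$ is a child of $v$, and distance between leaves $x,y$ equal to $\Delta(\mathrm{lca}(x,y))$.
   Formalization: The parameter α and the labels Δ(u) on the vertices of the HST take only rational values. -}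

module Defs where

open import Data.Nat as ℕ using (ℕ; ∣_-_∣)
open import Data.Fin using (Fin; toℕ)
open import Data.Fin.Subset using (Subset; _∈_)
open import Data.Integer using (+_)
open import Data.Rational using (ℚ; 0ℚ; _/_; _≤_; _<_; _*_)
open import Data.List using (List; []; _∷_; _++_; length; lookup)
open import Data.List.Relation.Unary.All using (All)
open import Data.List.Relation.Unary.Unique.Propositional using (Unique)
import Data.List.Membership.Propositional as L
open import Data.Product using (_×_; Σ)
open import Relation.Binary.PropositionalEquality using (_≡_; _≢_)

-- A finite rooted tree whose leaves carry points of M = {v_0,...,v_{n-1}}
-- (indexed by Fin n) and whose internal nodes carry a label Δ ∈ ℚ.
data Tree (n : ℕ) : Set where
  leaf : Fin n → Tree n
  node : ℚ → List (Tree n) → Tree n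

module _ {n : ℕ} where

  label : Tree n → ℚ
  label (leaf _)   = 0ℚ
  label (node Δ _) = Δ

  leaves     : Tree n → List (Fin n)
  leavesList : List (Tree n) → List (Fin n)
  leaves (leaf x)    = x ∷ []
  leaves (node _ ts) = leavesList ts
  leavesList []       = []
  leavesList (t ∷ ts) = leaves t ++ leavesList ts

  data WellFormed : Tree n → Set where
    leafWF : ∀ {x} → WellFormed (leaf x)
    nodeWF : ∀ {Δ ts} → 0ℚ < Δ → ts ≢ [] →
             All (λ t → label t ≤ Δ) ts → All WellFormed ts →
             WellFormed (node Δ ts)

  -- LCA t x y d : the least common ancestor of leaves x and y in t has label d.
  data LCA : Tree n → Fin n → Fin n → ℚ → Set where
    atLeaf : ∀ {x} → LCA (leaf x) x x 0ℚ
    atNode : ∀ {Δ ts x y} (i j : Fin (length ts)) → i ≢ j →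
             x L.∈ leaves (lookup ts i) → y L.∈ leaves (lookup ts j) →
             LCA (node Δ ts) x y Δ
    below  : ∀ {Δ ts x y d} (i : Fin (length ts)) →
             LCA (lookup ts i) x y d → LCA (node Δ ts) x y d

  IsHSTOn : Subset n → Tree n → Set
  IsHSTOn S t = WellFormed t × Unique (leaves t)
              × (∀ x → (x ∈ S → x L.∈ leaves t) × (x L.∈ leaves t → x ∈ S))

dM : ∀ {n} → Fin n → Fin n → ℚ
dM u v = (+ ∣ toℕ u - toℕ v ∣) / 1

ApproxByHST : ∀ {n} → ℚ → Subset n → Set
ApproxByHST {n} α S =
  Σ (Tree n) λ t → IsHSTOn S t ×
    (∀ u v d → u ∈ S → v ∈ S → LCA t u v d → (dM u v ≤ d) × (d ≤ α * dM u v))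

-- Let A ≥ α be an integer, r = 2A + 1 and b = r + 1. Split a window of b·ℓ consecutive
-- points into b blocks of length ℓ. If every block met S, points chosen in consecutive blocks
-- would be at line distance ≤ 2ℓ, hence at tree distance ≤ 2Aℓ, and by the ultrametric
-- inequality so would the points in the first and last block, whose line distance exceeds 2Aℓ.
-- So some block misses S, and by induction a window of length b^k contains at most r^k points
-- of S. With b^k ≈ n this is |S| ≤ b·n^(log_b r), and Bernoulli's inequality gives
-- r^(r²) ≤ b^(r² − 1), i.e. the exponent c = (r² − 1)/r² will do.
module Submission where

open import Defs
open import Data.Nat using (ℕ; _^_; _<_) renaming (_≤_ to _≤ℕ_; _*_ to _*ℕ_)
open import Data.Fin.Subset using (Subset; ∣_∣)
open import Data.Rational using (ℚ; 1ℚ) renaming (_≤_ to _≤ℚ_)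
open import Data.Product using (Σ; _×_)

open import Data.Nat using (zero; suc; pred; _+_; _*_; _∸_; _≤_; z≤n; s≤s; ∣_-_∣)
open import Data.Nat.Properties hiding (_≟_)
open import Data.Nat.Tactic.RingSolver using (solve-∀)
import Data.Nat.Coprimality as Coprime
open import Data.Integer as ℤ using (+≤+; -[1+_]; -≤+)
import Data.Integer.Properties as ℤ
import Data.Rational as ℚ
import Data.Rational.Properties as ℚ
open import Data.Bool using (true; false)
open import Data.Vec using ([]; _∷_; here; there)
open import Data.Fin using (Fin; zero; suc; toℕ; _≟_)
open import Data.Fin.Subset using (_∈_)
open import Data.Fin.Subset.Properties using (∣p∣≤n)
open import Data.List using (List; []; _∷_; _++_; length; lookup)
open import Data.List.Relation.Unary.All as All using (All; []; _∷_)
import Data.List.Relation.Unary.All.Properties as All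
open import Data.List.Relation.Unary.AllPairs using ([]; _∷_)
open import Data.List.Relation.Unary.Any using (here; there)
open import Data.List.Relation.Unary.Unique.Propositional using (Unique)
import Data.List.Membership.Propositional as L
open import Data.List.Membership.Propositional.Properties using (∈-++⁻; ∈-++⁺ˡ; ∈-++⁺ʳ; ∈-lookup)
open import Data.Product using (_,_; proj₁; proj₂)
open import Data.Sum using (_⊎_; inj₁; inj₂)
open import Data.Empty using (⊥; ⊥-elim)
open import Relation.Nullary using (yes; no)
open import Relation.Binary.PropositionalEquality
  using (_≡_; refl; cong; cong₂; subst; subst₂; sym; trans; module ≡-Reasoning)

fromℕ : ℕ → ℚ
fromℕ m = ℤ.+ m ℚ./ 1

fromℕ≡mkℚ : ∀ m → fromℕ m ≡ ℚ.mkℚ (ℤ.+ m) 0 (Coprime.sym (Coprime.1-coprimeTo m))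
fromℕ≡mkℚ m = ℚ.normalize-coprime (Coprime.sym (Coprime.1-coprimeTo m))

fromℕ-mono-≤ : ∀ {m k} → m ≤ k → fromℕ m ≤ℚ fromℕ k
fromℕ-mono-≤ {m} {k} m≤k rewrite fromℕ≡mkℚ m | fromℕ≡mkℚ k =
  ℚ.*≤* (subst₂ ℤ._≤_ (sym (ℤ.*-identityʳ (ℤ.+ m))) (sym (ℤ.*-identityʳ (ℤ.+ k))) (+≤+ m≤k))

fromℕ-cancel-≤ : ∀ {m k} → fromℕ m ≤ℚ fromℕ k → m ≤ k
fromℕ-cancel-≤ {m} {k} le rewrite fromℕ≡mkℚ m | fromℕ≡mkℚ k with le
... | ℚ.*≤* m*1≤k*1 with subst₂ ℤ._≤_ (ℤ.*-identityʳ (ℤ.+ m)) (ℤ.*-identityʳ (ℤ.+ k)) m*1≤k*1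
...   | +≤+ m≤k = m≤k

fromℕ-homo-* : ∀ m k → fromℕ m ℚ.* fromℕ k ≡ fromℕ (m * k)
fromℕ-homo-* m k = trans (cong₂ ℚ._*_ (fromℕ≡mkℚ m) (fromℕ≡mkℚ k)) (cong (ℚ._/ 1) (sym (ℤ.pos-* m k)))

≤-fromℕ : ∀ α → Σ ℕ λ A → α ≤ℚ fromℕ A
≤-fromℕ (ℚ.mkℚ (ℤ.+ k) d-1 c) = k , subst (ℚ.mkℚ (ℤ.+ k) d-1 c ≤ℚ_) (sym (fromℕ≡mkℚ k))
  (ℚ.*≤* (subst₂ ℤ._≤_ (sym (ℤ.*-identityʳ (ℤ.+ k))) (ℤ.pos-* k (suc d-1)) (+≤+ (m≤m*n k (suc d-1)))))
≤-fromℕ (ℚ.mkℚ -[1+ k ] d-1 c) = 0 , subst (ℚ.mkℚ -[1+ k ] d-1 c ≤ℚ_) (sym (fromℕ≡mkℚ 0))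
  (ℚ.*≤* (subst (λ m → m ℤ.≤ ℤ.+ 0 ℤ.* ℤ.+ suc d-1) (sym (ℤ.*-identityʳ -[1+ k ])) -≤+))

unique-++⁻ : ∀ {A : Set} (xs : List A) {ys} → Unique (xs ++ ys) →
             Unique xs × Unique ys × (∀ {x} → x L.∈ xs → x L.∈ ys → ⊥)
unique-++⁻ []       u          = [] , u , λ ()
unique-++⁻ (x ∷ xs) (x∉ ∷ u) with unique-++⁻ xs u | All.++⁻ xs x∉
... | uxs , uys , disjoint | x∉xs , x∉ys =
  x∉xs ∷ uxs , uys , λ { (here refl) x∈ys → All.lookup x∉ys x∈ys refl ; (there y∈xs) y∈ys → disjoint y∈xs y∈ys }

module _ {n : ℕ} where

  ∈-leavesList⁻ : ∀ (ts : List (Tree n)) {x} → x L.∈ leavesList ts →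
                  Σ (Fin (length ts)) λ i → x L.∈ leaves (lookup ts i)
  ∈-leavesList⁻ (t ∷ ts) x∈ with ∈-++⁻ (leaves t) x∈
  ... | inj₁ x∈t  = zero , x∈t
  ... | inj₂ x∈ts with ∈-leavesList⁻ ts x∈ts
  ...   | i , x∈tᵢ = suc i , x∈tᵢ

  ∈-leavesList⁺ : ∀ (ts : List (Tree n)) i {x} → x L.∈ leaves (lookup ts i) → x L.∈ leavesList ts
  ∈-leavesList⁺ (t ∷ ts) zero    x∈ = ∈-++⁺ˡ x∈
  ∈-leavesList⁺ (t ∷ ts) (suc i) x∈ = ∈-++⁺ʳ (leaves t) (∈-leavesList⁺ ts i x∈)

  unique-leaves-lookup : ∀ (ts : List (Tree n)) i → Unique (leavesList ts) → Unique (leaves (lookup ts i))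
  unique-leaves-lookup (t ∷ ts) zero    u = proj₁ (unique-++⁻ (leaves t) u)
  unique-leaves-lookup (t ∷ ts) (suc i) u = unique-leaves-lookup ts i (proj₁ (proj₂ (unique-++⁻ (leaves t) u)))

  unique-leaves-index : ∀ (ts : List (Tree n)) i j {x} → Unique (leavesList ts) →
                        x L.∈ leaves (lookup ts i) → x L.∈ leaves (lookup ts j) → i ≡ j
  unique-leaves-index (t ∷ ts) zero    zero    u x∈ᵢ x∈ⱼ = refl
  unique-leaves-index (t ∷ ts) zero    (suc j) u x∈ᵢ x∈ⱼ =
    ⊥-elim (proj₂ (proj₂ (unique-++⁻ (leaves t) u)) x∈ᵢ (∈-leavesList⁺ ts j x∈ⱼ))
  unique-leaves-index (t ∷ ts) (suc i) zero    u x∈ᵢ x∈ⱼ =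
    ⊥-elim (proj₂ (proj₂ (unique-++⁻ (leaves t) u)) x∈ⱼ (∈-leavesList⁺ ts i x∈ᵢ))
  unique-leaves-index (t ∷ ts) (suc i) (suc j) u x∈ᵢ x∈ⱼ =
    cong suc (unique-leaves-index ts i j (proj₁ (proj₂ (unique-++⁻ (leaves t) u))) x∈ᵢ x∈ⱼ)

  lca-leaves : ∀ {t x y d} → LCA t x y d → x L.∈ leaves t × y L.∈ leaves t
  lca-leaves atLeaf = here refl , here refl
  lca-leaves {node _ ts} (atNode i j _ x∈ y∈) = ∈-leavesList⁺ ts i x∈ , ∈-leavesList⁺ ts j y∈
  lca-leaves {node _ ts} (below i lca) with lca-leaves lca
  ... | x∈ , y∈ = ∈-leavesList⁺ ts i x∈ , ∈-leavesList⁺ ts i y∈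

  TreeDist≤ : Tree n → ℚ → Fin n → Fin n → Set
  TreeDist≤ t B x y = Σ ℚ λ d → LCA t x y d × d ≤ℚ B

  lca-exists : ∀ t {x y} → WellFormed t → x L.∈ leaves t → y L.∈ leaves t → TreeDist≤ t (label t) x y
  lca-exists-lookup : ∀ (ts : List (Tree n)) i {x y} → All WellFormed ts →
                      x L.∈ leaves (lookup ts i) → y L.∈ leaves (lookup ts i) →
                      TreeDist≤ (lookup ts i) (label (lookup ts i)) x y
  lca-exists (leaf _) leafWF (here refl) (here refl) = _ , atLeaf , ℚ.≤-refl
  lca-exists (node Δ ts) (nodeWF _ _ labels≤ wfs) x∈ y∈
    with ∈-leavesList⁻ ts x∈ | ∈-leavesList⁻ ts y∈
  ... | i , x∈ᵢ | j , y∈ⱼ with i ≟ j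
  ...   | no i≢j   = Δ , atNode i j i≢j x∈ᵢ y∈ⱼ , ℚ.≤-refl
  ...   | yes refl with lca-exists-lookup ts i wfs x∈ᵢ y∈ⱼ
  ...     | d , lca , d≤ = d , below i lca , ℚ.≤-trans d≤ (All.lookup labels≤ (∈-lookup i))
  lca-exists-lookup (t ∷ ts) zero    (wf ∷ _)   = lca-exists t wf
  lca-exists-lookup (t ∷ ts) (suc i) (_  ∷ wfs) = lca-exists-lookup ts i wfs

  -- Ultrametric inequality: if the two LCAs differ, one of them is an ancestor of both
  -- x and z, and the LCA of x and z lies below it.
  lca-ultrametric : ∀ {t x y z d₁ d₂ B} → WellFormed t → Unique (leaves t) →
                    LCA t x y d₁ → LCA t y z d₂ → d₁ ≤ℚ B → d₂ ≤ℚ B → TreeDist≤ t B x z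
  lca-ultrametric wf u atLeaf yz _ d₂≤B = _ , yz , d₂≤B
  lca-ultrametric {t} wf u xy@(atNode _ _ _ _ _) yz Δ≤B _
    with lca-exists t wf (proj₁ (lca-leaves xy)) (proj₂ (lca-leaves yz))
  ... | d , xz , d≤Δ = d , xz , ℚ.≤-trans d≤Δ Δ≤B
  lca-ultrametric {t} wf u xy@(below _ _) yz@(atNode _ _ _ _ _) _ Δ≤B
    with lca-exists t wf (proj₁ (lca-leaves xy)) (proj₂ (lca-leaves yz))
  ... | d , xz , d≤Δ = d , xz , ℚ.≤-trans d≤Δ Δ≤B
  lca-ultrametric {node _ ts} (nodeWF _ _ _ wfs) u (below i xy) (below j yz) d₁≤B d₂≤B
    with unique-leaves-index ts i j u (proj₂ (lca-leaves xy)) (proj₁ (lca-leaves yz))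
  ... | refl with lca-ultrametric (All.lookup wfs (∈-lookup i)) (unique-leaves-lookup ts i u) xy yz d₁≤B d₂≤B
  ...   | d , xz , d≤B = d , below i xz , d≤B

  treeDist-trans : ∀ {t x y z B} → WellFormed t → Unique (leaves t) →
                   TreeDist≤ t B x y → TreeDist≤ t B y z → TreeDist≤ t B x z
  treeDist-trans wf u (_ , xy , d₁≤B) (_ , yz , d₂≤B) = lca-ultrametric wf u xy yz d₁≤B d₂≤B

sumFrom : (ℕ → ℕ) → ℕ → ℕ → ℕ
sumFrom f a zero    = 0
sumFrom f a (suc L) = f a + sumFrom f (suc a) L

sumFrom-suc : ∀ f a L → sumFrom f (suc a) L ≡ sumFrom (λ i → f (suc i)) a L
sumFrom-suc f a zero    = refl
sumFrom-suc f a (suc L) = cong (f (suc a) +_) (sumFrom-suc f (suc a) L)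

sumFrom-+ : ∀ f a L M → sumFrom f a (L + M) ≡ sumFrom f a L + sumFrom f (a + L) M
sumFrom-+ f a zero    M = cong (λ a′ → sumFrom f a′ M) (sym (+-identityʳ a))
sumFrom-+ f a (suc L) M = begin
  f a + sumFrom f (suc a) (L + M)                        ≡⟨ cong (f a +_) (sumFrom-+ f (suc a) L M) ⟩
  f a + (sumFrom f (suc a) L + sumFrom f (suc a + L) M)  ≡⟨ cong (λ a′ → f a + (sumFrom f (suc a) L + sumFrom f a′ M)) (sym (+-suc a L)) ⟩
  f a + (sumFrom f (suc a) L + sumFrom f (a + suc L) M)  ≡⟨ sym (+-assoc (f a) _ _) ⟩
  f a + sumFrom f (suc a) L + sumFrom f (a + suc L) M    ∎
  where open ≡-Reasoning

sumFrom-≤ : ∀ f → (∀ i → f i ≤ 1) → ∀ a L → sumFrom f a L ≤ L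
sumFrom-≤ f f≤1 a zero    = z≤n
sumFrom-≤ f f≤1 a (suc L) = +-mono-≤ (f≤1 a) (sumFrom-≤ f f≤1 (suc a) L)

sumFrom-pos : ∀ f a L → 1 ≤ sumFrom f a L → Σ ℕ λ i → a ≤ i × i < a + L × 1 ≤ f i
sumFrom-pos f a (suc L) pos with f a in fa≡
... | suc _ = a , ≤-refl , subst (a <_) (sym (+-suc a L)) (s≤s (m≤m+n a L)) , subst (1 ≤_) (sym fa≡) (s≤s z≤n)
... | zero with sumFrom-pos f (suc a) L pos
...   | i , a<i , i<a+1+L , fi≥1 = i , <⇒≤ a<i , subst (i <_) (sym (+-suc a L)) i<a+1+L , fi≥1

indicator : ∀ {n} → Subset n → ℕ → ℕ
indicator []           i       = 0
indicator (_     ∷ xs) (suc i) = indicator xs i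
indicator (true  ∷ _)  zero    = 1
indicator (false ∷ _)  zero    = 0

indicator≤1 : ∀ {n} (S : Subset n) i → indicator S i ≤ 1
indicator≤1 []           i       = z≤n
indicator≤1 (_     ∷ xs) (suc i) = indicator≤1 xs i
indicator≤1 (true  ∷ _)  zero    = s≤s z≤n
indicator≤1 (false ∷ _)  zero    = z≤n

indicator-pos : ∀ {n} (S : Subset n) i → 1 ≤ indicator S i → Σ (Fin n) λ x → toℕ x ≡ i × x ∈ S
indicator-pos (_    ∷ xs) (suc i) pos with indicator-pos xs i pos
... | x , refl , x∈ = suc x , refl , there x∈
indicator-pos (true ∷ _)  zero    _ = zero , refl , here

∣S∣≡sumFrom-indicator : ∀ {n} (S : Subset n) → ∣ S ∣ ≡ sumFrom (indicator S) 0 n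
∣S∣≡sumFrom-indicator []        = refl
∣S∣≡sumFrom-indicator {suc n} (true  ∷ xs) =
  cong suc (trans (∣S∣≡sumFrom-indicator xs) (sym (sumFrom-suc (indicator (true ∷ xs)) 0 n)))
∣S∣≡sumFrom-indicator {suc n} (false ∷ xs) =
  trans (∣S∣≡sumFrom-indicator xs) (sym (sumFrom-suc (indicator (false ∷ xs)) 0 n))

∣m-n∣≤k : ∀ {m n k} → m ≤ n → n ≤ m + k → ∣ m - n ∣ ≤ k
∣m-n∣≤k {m} {n} {k} m≤n n≤m+k = begin
  ∣ m - n ∣  ≡⟨ m≤n⇒∣m-n∣≡n∸m m≤n ⟩
  n ∸ m      ≤⟨ ∸-monoˡ-≤ m n≤m+k ⟩
  m + k ∸ m  ≡⟨ m+n∸m≡n m k ⟩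
  k          ∎
  where open ≤-Reasoning

k<∣m-n∣ : ∀ {m n k} → m + suc k ≤ n → k < ∣ m - n ∣
k<∣m-n∣ {m} {n} {k} m+1+k≤n = begin
  suc k          ≡⟨ m+n∸m≡n m (suc k) ⟨
  m + suc k ∸ m  ≤⟨ ∸-monoˡ-≤ m m+1+k≤n ⟩
  n ∸ m          ≡⟨ m≤n⇒∣m-n∣≡n∸m (≤-trans (m≤m+n m (suc k)) m+1+k≤n) ⟨
  ∣ m - n ∣      ∎
  where open ≤-Reasoning

-- x ∼[ R ] y stands for ρ(x, y) ≤ R, for an ultrametric ρ on S with d_M ≤ ρ ≤ A d_M.
module WindowBound {n} (S : Subset n) (A : ℕ)
  (_∼[_]_ : Fin n → ℕ → Fin n → Set)
  (∼-trans : ∀ {R x y z} → x ∼[ R ] y → y ∼[ R ] z → x ∼[ R ] z)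
  (∼-near  : ∀ {K x y} → x ∈ S → y ∈ S → ∣ toℕ x - toℕ y ∣ ≤ K → x ∼[ A * K ] y)
  (∼-far   : ∀ {R x y} → x ∈ S → y ∈ S → x ∼[ R ] y → ∣ toℕ x - toℕ y ∣ ≤ R)
  where

  r b : ℕ
  r = suc (A + A)
  b = suc r

  count : ℕ → ℕ → ℕ
  count = sumFrom (indicator S)

  empty-or-occupied : ∀ a L → count a L ≡ 0 ⊎ Σ (Fin n) λ x → x ∈ S × a ≤ toℕ x × toℕ x < a + L
  empty-or-occupied a L with count a L in eq
  ... | zero  = inj₁ refl
  ... | suc _ with sumFrom-pos (indicator S) a L (subst (1 ≤_) (sym eq) (s≤s z≤n))
  ...   | i , a≤i , i<a+L , pos with indicator-pos S i pos
  ...     | x , refl , x∈S = inj₂ (x , x∈S , a≤i , i<a+L)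

  module Step (ℓ h : ℕ) (sparse : ∀ a → count a ℓ ≤ h) where

    count-blocks : ∀ m a → count a (m * ℓ) ≤ m * h
    count-blocks zero    a = z≤n
    count-blocks (suc m) a = subst (_≤ suc m * h) (sym (sumFrom-+ (indicator S) a ℓ (m * ℓ)))
                               (+-mono-≤ (sparse a) (count-blocks m (a + ℓ)))

    Chain : ℕ → ℕ → Set
    Chain a m = Σ (Fin n) λ x → Σ (Fin n) λ z → x ∈ S × z ∈ S ×
                a ≤ toℕ x × toℕ x < a + ℓ × a + m * ℓ ≤ toℕ z × x ∼[ A * (ℓ + ℓ) ] z

    sparse-or-chain : ∀ m a → count a (suc m * ℓ) ≤ m * h ⊎ Chain a m
    sparse-or-chain m a with empty-or-occupied a ℓ
    ... | inj₁ empty = inj₁ (subst (_≤ m * h)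
            (sym (trans (sumFrom-+ (indicator S) a ℓ (m * ℓ)) (cong (_+ count (a + ℓ) (m * ℓ)) empty)))
            (count-blocks m (a + ℓ)))
    ... | inj₂ (x , x∈S , a≤x , x<a+ℓ) = extend m
      where
      extend : ∀ m → count a (suc m * ℓ) ≤ m * h ⊎ Chain a m
      extend zero = inj₂ (x , x , x∈S , x∈S , a≤x , x<a+ℓ , subst (_≤ toℕ x) (sym (+-identityʳ a)) a≤x ,
                          ∼-near x∈S x∈S (subst (_≤ ℓ + ℓ) (sym (∣n-n∣≡0 (toℕ x))) z≤n))
      extend (suc m) with sparse-or-chain m (a + ℓ)
      ... | inj₁ rest = inj₁ (subst (_≤ suc m * h) (sym (sumFrom-+ (indicator S) a ℓ (suc m * ℓ)))
                                (+-mono-≤ (sparse a) rest))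
      ... | inj₂ (y , z , y∈S , z∈S , a+ℓ≤y , y<a+ℓ+ℓ , a+ℓ+mℓ≤z , y∼z) =
        inj₂ (x , z , x∈S , z∈S , a≤x , x<a+ℓ , subst (_≤ toℕ z) (+-assoc a ℓ (m * ℓ)) a+ℓ+mℓ≤z ,
              ∼-trans (∼-near x∈S y∈S x-y≤2ℓ) y∼z)
        where
        x-y≤2ℓ : ∣ toℕ x - toℕ y ∣ ≤ ℓ + ℓ
        x-y≤2ℓ = ∣m-n∣≤k (≤-trans (<⇒≤ x<a+ℓ) a+ℓ≤y)
                   (≤-trans (<⇒≤ y<a+ℓ+ℓ) (≤-trans (≤-reflexive (+-assoc a ℓ ℓ)) (+-monoˡ-≤ (ℓ + ℓ) a≤x)))

    no-long-chain : ∀ {a} → Chain a r → ⊥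
    no-long-chain {a} (x , z , x∈S , z∈S , _ , x<a+ℓ , a+rℓ≤z , x∼z) = <⇒≱ far near
      where
      near : ∣ toℕ x - toℕ z ∣ ≤ (A + A) * ℓ
      near = subst (∣ toℕ x - toℕ z ∣ ≤_) (trans (*-distribˡ-+ A ℓ ℓ) (sym (*-distribʳ-+ ℓ A A)))
               (∼-far x∈S z∈S x∼z)
      far : (A + A) * ℓ < ∣ toℕ x - toℕ z ∣
      far = k<∣m-n∣ (≤-trans (subst (_≤ a + ℓ + (A + A) * ℓ) (sym (+-suc (toℕ x) _)) (+-monoˡ-≤ _ x<a+ℓ))
                             (≤-trans (≤-reflexive (+-assoc a ℓ _)) a+rℓ≤z))

    count-step : ∀ a → count a (b * ℓ) ≤ r * h
    count-step a with sparse-or-chain r a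
    ... | inj₁ sparse-window = sparse-window
    ... | inj₂ chain         = ⊥-elim (no-long-chain chain)

  count-window : ∀ k a → count a (b ^ k) ≤ r ^ k
  count-window zero    a = sumFrom-≤ (indicator S) (indicator≤1 S) a 1
  count-window (suc k) a = Step.count-step (b ^ k) (r ^ k) (count-window k) a

  size-bound : ∀ k → n ≤ b ^ k → ∣ S ∣ ≤ r ^ k
  size-bound k n≤bᵏ = begin
    ∣ S ∣                            ≡⟨ ∣S∣≡sumFrom-indicator S ⟩
    count 0 n                        ≤⟨ m≤m+n (count 0 n) _ ⟩
    count 0 n + count n (b ^ k ∸ n)  ≡⟨ sumFrom-+ (indicator S) 0 n (b ^ k ∸ n) ⟨
    count 0 (n + (b ^ k ∸ n))        ≡⟨ cong (count 0) (m+[n∸m]≡n n≤bᵏ) ⟩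
    count 0 (b ^ k)                  ≤⟨ count-window k 0 ⟩
    r ^ k                            ∎
    where open ≤-Reasoning

bernoulli : ∀ r j → r ^ j * (r + j) ≤ r * suc r ^ j
bernoulli r zero    = ≤-reflexive (trans (+-identityʳ (r + 0)) (trans (+-identityʳ r) (sym (*-identityʳ r))))
bernoulli r (suc j) = begin
  r * r ^ j * (r + suc j)          ≡⟨ cong (r * r ^ j *_) (+-suc r j) ⟩
  r * r ^ j * suc (r + j)          ≡⟨ expand r (r ^ j) (r + j) ⟩
  r ^ j * (r * (r + j) + r)        ≤⟨ *-monoʳ-≤ (r ^ j) (+-monoʳ-≤ (r * (r + j)) (m≤m+n r j)) ⟩
  r ^ j * (r * (r + j) + (r + j))  ≡⟨ collect r (r ^ j) (r + j) ⟩
  suc r * (r ^ j * (r + j))        ≤⟨ *-monoʳ-≤ (suc r) (bernoulli r j) ⟩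
  suc r * (r * suc r ^ j)          ≡⟨ *-comm-left r (suc r) (suc r ^ j) ⟩
  r * (suc r * suc r ^ j)          ∎
  where
  open ≤-Reasoning
  expand : ∀ r x y → r * x * suc y ≡ x * (r * y + r)
  expand = solve-∀
  collect : ∀ r x y → x * (r * y + y) ≡ suc r * (x * y)
  collect = solve-∀
  *-comm-left : ∀ x y z → y * (x * z) ≡ x * (y * z)
  *-comm-left = solve-∀

-- Bernoulli with j = r² gives r^(r²) (r + r²) ≤ r (r+1)^(r²); divide by r (r + 1).
pow-square≤ : ∀ r → r ^ (r * r) ≤ suc r ^ pred (r * r)
pow-square≤ zero       = ≤-refl
pow-square≤ r@(suc r′) = *-cancelˡ-≤ (r * suc r) (begin
  r * suc r * r ^ q        ≡⟨ *-comm (r * suc r) (r ^ q) ⟩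
  r ^ q * (r * suc r)      ≡⟨ cong (r ^ q *_) (*-suc r r) ⟩
  r ^ q * (r + q)          ≤⟨ bernoulli r q ⟩
  r * suc r ^ q            ≡⟨ sym (*-assoc r (suc r) (suc r ^ p)) ⟩
  r * suc r * suc r ^ p    ∎)
  where
  open ≤-Reasoning
  q = r * r
  p = pred q

n<[2+c]^n : ∀ c n → n < suc (suc c) ^ n
n<[2+c]^n c zero    = s≤s z≤n
n<[2+c]^n c (suc n) = begin-strict
  suc n                               <⟨ s≤s (n<[2+c]^n c n) ⟩
  1 + suc (suc c) ^ n                 ≤⟨ +-monoˡ-≤ (suc (suc c) ^ n) (m^n>0 (suc (suc c)) n) ⟩
  suc (suc c) ^ n + suc (suc c) ^ n   ≤⟨ +-monoʳ-≤ (suc (suc c) ^ n) (m≤n*m (suc (suc c) ^ n) (suc c)) ⟩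
  suc (suc c) ^ suc n                 ∎
  where open ≤-Reasoning

power-bracket : ∀ b j {n} → 1 ≤ n → n < b ^ j → Σ ℕ λ k → b ^ k ≤ n × n < b ^ suc k
power-bracket b zero    (s≤s z≤n) (s≤s ())
power-bracket b (suc j) {n} 1≤n n<bʲ⁺¹ with n <? b ^ j
... | yes n<bʲ = power-bracket b j 1≤n n<bʲ
... | no  n≮bʲ = j , ≮⇒≥ n≮bʲ , n<bʲ⁺¹

^-swap : ∀ m a c → (m ^ a) ^ c ≡ (m ^ c) ^ a
^-swap m a c = trans (^-*-assoc m a c) (trans (cong (m ^_) (*-comm a c)) (sym (^-*-assoc m c a)))

power-interpolate : ∀ c {r p s n} → let b = suc (suc c) in
                    r ^ suc p ≤ b ^ p → s ≤ n → (∀ k → n ≤ b ^ k → s ≤ r ^ k) →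
                    s ^ suc p ≤ b ^ suc p * n ^ p
power-interpolate c {n = zero}  _ z≤n _ = z≤n
power-interpolate c {r} {p} {s} {n@(suc _)} rᵖ⁺¹≤bᵖ _ s≤rᵏ
  with power-bracket (suc (suc c)) n (s≤s z≤n) (n<[2+c]^n c n)
... | k , bᵏ≤n , n<bᵏ⁺¹ = begin
  s ^ q                  ≤⟨ ^-monoˡ-≤ q (s≤rᵏ (suc k) (<⇒≤ n<bᵏ⁺¹)) ⟩
  (r ^ suc k) ^ q        ≡⟨ ^-swap r (suc k) q ⟩
  (r ^ q) ^ suc k        ≤⟨ ^-monoˡ-≤ (suc k) rᵖ⁺¹≤bᵖ ⟩
  b ^ p * (b ^ p) ^ k    ≡⟨ cong (b ^ p *_) (^-swap b p k) ⟩
  b ^ p * (b ^ k) ^ p    ≤⟨ *-mono-≤ (^-monoʳ-≤ b (n≤1+n p)) (^-monoˡ-≤ p bᵏ≤n) ⟩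
  b ^ q * n ^ p          ∎
  where
  open ≤-Reasoning
  b = suc (suc c)
  q = suc p

approx⇒size-bound : ∀ {α A n} {S : Subset n} → α ≤ℚ fromℕ A → ℚ.0ℚ ≤ℚ α → ApproxByHST α S →
                    ∀ k → n ≤ suc (suc (A + A)) ^ k → ∣ S ∣ ≤ suc (A + A) ^ k
approx⇒size-bound {α} {A} {S = S} α≤A 0≤α (t , (wf , unique , S⇔leaves) , distortion) =
  WindowBound.size-bound S A (λ x R y → TreeDist≤ t (fromℕ R) x y) (treeDist-trans wf unique) near far
  where
  near : ∀ {K x y} → x ∈ S → y ∈ S → ∣ toℕ x - toℕ y ∣ ≤ K → TreeDist≤ t (fromℕ (A * K)) x y
  near {K} {x} {y} x∈S y∈S x-y≤K
    with lca-exists t wf (proj₁ (S⇔leaves x) x∈S) (proj₁ (S⇔leaves y) y∈S)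
  ... | d , lca , _ = d , lca , (begin
    d                    ≤⟨ proj₂ (distortion x y d x∈S y∈S lca) ⟩
    α ℚ.* dM x y         ≤⟨ ℚ.*-monoˡ-≤-nonNeg α {{ℚ.nonNegative 0≤α}} (fromℕ-mono-≤ x-y≤K) ⟩
    α ℚ.* fromℕ K        ≤⟨ ℚ.*-monoʳ-≤-nonNeg (fromℕ K) {{ℚ.nonNegative (fromℕ-mono-≤ {0} {K} z≤n)}} α≤A ⟩
    fromℕ A ℚ.* fromℕ K  ≡⟨ fromℕ-homo-* A K ⟩
    fromℕ (A * K)        ∎)
    where open ℚ.≤-Reasoning
  far : ∀ {R x y} → x ∈ S → y ∈ S → TreeDist≤ t (fromℕ R) x y → ∣ toℕ x - toℕ y ∣ ≤ R
  far x∈S y∈S (d , lca , d≤R) = fromℕ-cancel-≤ (ℚ.≤-trans (proj₁ (distortion _ _ d x∈S y∈S lca)) d≤R)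

proposition7p9 : (α : ℚ) → 1ℚ ≤ℚ α →
    Σ ℕ λ p → Σ ℕ λ q → Σ ℕ λ C → p < q ×
      ((n : ℕ) (S : Subset n) → ApproxByHST α S →
        ∣ S ∣ ^ q ≤ℕ (C ^ q) *ℕ (n ^ p))
proposition7p9 α 1≤α with ≤-fromℕ α
... | A , α≤A = pred (r * r) , r * r , suc r , ≤-refl , λ n S approx →
  power-interpolate (A + A) {p = pred (r * r)} (pow-square≤ r) (∣p∣≤n S) (approx⇒size-bound {A = A} α≤A 0≤α approx)
  where
  r = suc (A + A)
  0≤α = ℚ.≤-trans (ℚ.nonNegative⁻¹ 1ℚ) 1≤α
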